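{- Every graph $H$ is the $\gamma_L$-graph of infinitely many graphs; that is, for every graph $H$ there exist infinitely many graphs $G$ with $G(\gamma_L)\cong H$.
   Context: For a graph $G$, a set $S\subseteq V(G)$ is locating-dominating if it is dominating and the sets $N[v]\cap S$, for $v\in V(G)-S$, are pairwise distinct. $\gamma_L(G)$ is the minimum cardinality of a locating-dominating set, and a $\gamma_L$-set is a locating-dominating set of that cardinality. The $\gamma_L$-graph $G(\gamma_L)$ has one vertex for each $\gamma_L$-set of $G$, and the vertices corresponding to $S_u,S_w$ are adjacent iff there exist $u'\in S_u$, $w'\in S_w$ with $u'w'\in E(G)$ and $S_w=(S_u-\{u'\})\cup\{w'\}$. -}

module Defs where

open import Data.Nat using (ℕ; _≤_)
open import Data.Bool using (Bool; true; false; _∨_; _∧_)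
open import Data.Fin using (Fin)
open import Data.Fin.Subset using (Subset; _∈_; _∉_; _∩_; _∪_; ⁅_⁆; ∣_∣; ∁; Nonempty)
open import Data.Fin.Properties using (_≟_)
open import Data.Vec using (tabulate)
open import Data.Product using (Σ; ∃; _×_; _,_)
open import Relation.Nullary using (¬_; does)
open import Relation.Binary.PropositionalEquality using (_≡_; _≢_)
open import Function.Bundles using (_↔_; Inverse)
open import Function.Definitions using (Injective)

record Graph : Set where
  field
    order : ℕ
    adj   : Fin order → Fin order → Bool
    sym   : ∀ u v → adj u v ≡ adj v u
    irrefl : ∀ v → adj v v ≡ false
open Graph public

_─_ : ∀ {n} → Subset n → Subset n → Subset n
S ─ T = S ∩ ∁ T

module _ (G : Graph) where
  private n = order G

  N[_] : Fin n → Subset n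
  N[ v ] = tabulate (λ w → does (v ≟ w) ∨ adj G v w)

  IsDominating : Subset n → Set
  IsDominating S = ∀ v → Nonempty (N[ v ] ∩ S)

  IsLocatingDominating : Subset n → Set
  IsLocatingDominating S =
    IsDominating S ×
    (∀ u v → u ∉ S → v ∉ S → u ≢ v → (N[ u ] ∩ S) ≢ (N[ v ] ∩ S))

  IsγLSet : Subset n → Set
  IsγLSet S = IsLocatingDominating S × (∀ T → IsLocatingDominating T → ∣ S ∣ ≤ ∣ T ∣)

  γLAdj : Subset n → Subset n → Set
  γLAdj Su Sw = Σ (Fin n) λ u′ → Σ (Fin n) λ w′ →
    u′ ∈ Su × w′ ∈ Sw × adj G u′ w′ ≡ true × Sw ≡ (Su ─ ⁅ u′ ⁆) ∪ ⁅ w′ ⁆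

_≅γL_ : Graph → Graph → Set
H ≅γL G = Σ (Fin (order H) → Subset (order G)) λ f →
  (∀ i → IsγLSet G (f i)) ×
  Injective _≡_ _≡_ f ×
  (∀ S → IsγLSet G S → ∃ λ i → f i ≡ S) ×
  (∀ i j → (adj H i j ≡ true → γLAdj G (f i) (f j)) × (γLAdj G (f i) (f j) → adj H i j ≡ true))

_≅_ : Graph → Graph → Set
G ≅ G′ = Σ (Fin (order G) ↔ Fin (order G′)) λ e →
  ∀ u v → adj G u v ≡ adj G′ (Inverse.to e u) (Inverse.to e v)

module Submission where

-- G_k has vertices Y, Z, a copy A_j of each vertex j of H (inducing H), and
-- m = n + k + 1 paths Q_b P_b R_b S_b T_b, with further edges Y A_j, Z A_j, Y P_0,
-- A_j P_(j+1) and A_j S_0.  The closed neighbourhoods of the 2m + 1 vertices Z, Q_b,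
-- T_b are pairwise disjoint, so by a packing bound every dominating set has at
-- least 2m + 1 vertices; the sets S_i = {A_i} ∪ {P_b} ∪ {S_b} are locating-
-- dominating of exactly that size, hence γ_L-sets.  Conversely a γ_L-set meets
-- each packing neighbourhood exactly once and nothing else, and the locating
-- condition then forces it to be some S_i.  Since S_j arises from S_i by exchanging
-- A_i for A_j, an exchange lemma shows that S_i, S_j are adjacent in G_k(γ_L) iff
-- ij ∈ E(H).  Finally G_k has 2 + n + 5m vertices, so the G_k are non-isomorphic.

open import Defs
open import Data.Nat using (ℕ; suc; _+_; _*_; _≤_)
import Data.Nat.Properties as ℕ
open import Data.Bool using (Bool; true; false; _∨_; _∧_)
open import Data.Bool.Properties using (∧-comm; ∨-comm; ∨-idem; ∨-identityʳ; ¬-not)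
open import Data.Unit using (⊤; tt)
import Data.Unit.Properties as Unit
open import Data.Fin using (Fin; zero; suc; _↑ˡ_; _↑ʳ_; splitAt; fromℕ<)
open import Data.Fin.Properties
  using (_≟_; suc-injective; ↑ˡ-injective; splitAt-↑ˡ; splitAt-↑ʳ; join-splitAt;
         injective⇒≤; any?; +↔⊎; 1↔⊤; cantor-schröder-bernstein)
open import Data.Fin.Subset using (Subset; _∈_; _∉_; _∩_; _∪_; ⁅_⁆; ∣_∣; ∁; _⊆_)
open import Data.Fin.Subset.Properties
  using (x∈p∩q⁺; x∈p∩q⁻; x∈p∪q⁺; x∈p∪q⁻; x∈⁅x⁆; x∈⁅y⁆⇒x≡y; x≢y⇒x∉⁅y⁆; x∉⁅y⁆⇒x≢y;
         x∈∁p⇒x∉p; x∉p⇒x∈∁p; ⊆-antisym)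
open import Data.Vec using (_∷_; lookup; tabulate; here; there)
open import Data.Vec.Properties
  using (lookup∘tabulate; tabulate∘lookup; tabulate-cong; lookup-zipWith; lookup-replicate;
         []=⇒lookup; lookup⇒[]=)
open import Data.Sum using (_⊎_; inj₁; inj₂; [_,_]′)
open import Data.Sum.Properties using (≡-dec)
open import Data.Sum.Function.Propositional using (_⊎-↔_)
open import Data.Product using (Σ; ∃; _×_; _,_; proj₁; proj₂)
open import Data.Empty using (⊥-elim)
open import Function using (_∘_; _∋_)
open import Function.Bundles using (_↔_; Inverse; Injection; mk⇔)
open import Function.Definitions using (Injective)
open import Function.Properties.Inverse using (↔-trans; ↔-sym; ↔-refl; ↔⇒↣)
open import Relation.Binary.Definitions using (DecidableEquality)
open import Relation.Binary.PropositionalEquality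
  using (_≡_; _≢_; refl; cong; cong₂; trans; subst; subst₂; ≢-sym; module ≡-Reasoning)
  renaming (sym to ≡-sym)
open import Relation.Nullary using (¬_; Dec; does; yes; no; contradiction)
open import Relation.Nullary.Decidable using (dec-true; dec-false; does-⇔)

element : ∀ {n} (S : Subset n) → Fin ∣ S ∣ → Fin n
element (true  ∷ S) zero    = zero
element (true  ∷ S) (suc i) = suc (element S i)
element (false ∷ S) i       = suc (element S i)

element-∈ : ∀ {n} (S : Subset n) i → element S i ∈ S
element-∈ (true  ∷ S) zero    = here
element-∈ (true  ∷ S) (suc i) = there (element-∈ S i)
element-∈ (false ∷ S) i       = there (element-∈ S i)

element-injective : ∀ {n} (S : Subset n) → Injective _≡_ _≡_ (element S)
element-injective (true  ∷ S) {zero}  {zero}  _  = refl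
element-injective (true  ∷ S) {zero}  {suc _} ()
element-injective (true  ∷ S) {suc _} {zero}  ()
element-injective (true  ∷ S) {suc i} {suc j} eq = cong suc (element-injective S (suc-injective eq))
element-injective (false ∷ S) eq = element-injective S (suc-injective eq)

position : ∀ {n} (S : Subset n) {x} → x ∈ S → Fin ∣ S ∣
position (true  ∷ S) here        = zero
position (true  ∷ S) (there x∈S) = suc (position S x∈S)
position (false ∷ S) (there x∈S) = position S x∈S

element-position : ∀ {n} (S : Subset n) {x} (x∈S : x ∈ S) → element S (position S x∈S) ≡ x
element-position (true  ∷ S) here        = refl
element-position (true  ∷ S) (there x∈S) = cong suc (element-position S x∈S)
element-position (false ∷ S) (there x∈S) = cong suc (element-position S x∈S)

≤-size : ∀ {n K} (S : Subset n) (f : Fin K → Fin n) →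
         Injective _≡_ _≡_ f → (∀ c → f c ∈ S) → K ≤ ∣ S ∣
≤-size S f f-injective f∈S = injective⇒≤ {f = λ c → position S (f∈S c)} λ {c} {d} eq →
  f-injective (trans (≡-sym (element-position S (f∈S c)))
              (trans (cong (element S) eq) (element-position S (f∈S d))))

size-≤ : ∀ {n K} (S : Subset n) (f : Fin K → Fin n) →
         (∀ {x} → x ∈ S → ∃ λ c → f c ≡ x) → ∣ S ∣ ≤ K
size-≤ S f cover = injective⇒≤ {f = λ i → proj₁ (cover (element-∈ S i))} λ {i} {j} eq →
  element-injective S (trans (≡-sym (proj₂ (cover (element-∈ S i))))
                      (trans (cong f eq) (proj₂ (cover (element-∈ S j)))))

subset-ext : ∀ {n} {p q : Subset n} → (∀ x → lookup p x ≡ lookup q x) → p ≡ q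
subset-ext {p = p} {q} p≗q = trans (≡-sym (tabulate∘lookup p)) (trans (tabulate-cong p≗q) (tabulate∘lookup q))

lookup-⁅⁆ : ∀ {n} (a x : Fin n) → lookup ⁅ a ⁆ x ≡ does (a ≟ x)
lookup-⁅⁆ zero    zero    = refl
lookup-⁅⁆ zero    (suc x) = lookup-replicate x false
lookup-⁅⁆ (suc a) zero    = refl
lookup-⁅⁆ (suc a) (suc x) = lookup-⁅⁆ a x

false⇒∉ : ∀ {n} {S : Subset n} {x} → lookup S x ≡ false → x ∉ S
false⇒∉ S[x]≡false x∈S with () ← trans (≡-sym ([]=⇒lookup x∈S)) S[x]≡false

decided : ∀ {A : Set} (a? : Dec A) → does a? ≡ true → A
decided (yes a) _  = a
decided (no _)  ()

apart : ∀ {x y : Bool} → x ≡ true → y ≡ false → x ≢ y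
apart refl refl ()

-- A packing of G: K centres whose closed neighbourhoods are pairwise disjoint,
-- witnessed by a labelling `block` sending every vertex of N[centre c] to c.
module Packing (G : Graph) {K : ℕ} (centre : Fin K → Fin (order G))
               (block : Fin (order G) → Fin K)
               (block-centre : ∀ c {x} → x ∈ N[_] G (centre c) → block x ≡ c) where

  module _ {S : Subset (order G)} (dominating : IsDominating G S) where

    guard : Fin K → Fin (order G)
    guard c = proj₁ (dominating (centre c))

    guard-∈ : ∀ c → guard c ∈ S
    guard-∈ c = proj₂ (x∈p∩q⁻ _ S (proj₂ (dominating (centre c))))

    guard-near : ∀ c → guard c ∈ N[_] G (centre c)
    guard-near c = proj₁ (x∈p∩q⁻ _ S (proj₂ (dominating (centre c))))

    block-guard : ∀ c → block (guard c) ≡ c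
    block-guard c = block-centre c (guard-near c)

    -- The guards are distinct because the neighbourhoods are disjoint.
    guard-injective : Injective _≡_ _≡_ guard
    guard-injective {c} {d} eq = trans (≡-sym (block-guard c)) (trans (cong block eq) (block-guard d))

    packing-bound : K ≤ ∣ S ∣
    packing-bound = ≤-size S guard guard-injective guard-∈

    -- When S has no more than K members, the guards are all of S: each member of S
    -- is the guard of its own block.
    module Tight (tight : ∣ S ∣ ≤ K) where

      guard-block : ∀ {x} → x ∈ S → guard (block x) ≡ x
      guard-block {x} x∈S with any? (λ c → guard c ≟ x)
      ... | yes (c , guard-c≡x) =
        trans (cong guard (trans (cong block (≡-sym guard-c≡x)) (block-guard c))) guard-c≡x
      ... | no unguarded = contradiction (ℕ.≤-trans (≤-size S guards⁺ guards⁺-injective guards⁺-∈) tight) ℕ.1+n≰n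
        where
        -- x together with the guards would be K + 1 distinct members of S
        guards⁺ : Fin (suc K) → Fin (order G)
        guards⁺ zero    = x
        guards⁺ (suc c) = guard c

        guards⁺-injective : Injective _≡_ _≡_ guards⁺
        guards⁺-injective {zero}  {zero}  _  = refl
        guards⁺-injective {zero}  {suc d} eq = ⊥-elim (unguarded (d , ≡-sym eq))
        guards⁺-injective {suc c} {zero}  eq = ⊥-elim (unguarded (c , eq))
        guards⁺-injective {suc c} {suc d} eq = cong suc (guard-injective eq)

        guards⁺-∈ : ∀ c → guards⁺ c ∈ S
        guards⁺-∈ zero    = x∈S
        guards⁺-∈ (suc c) = guard-∈ c

      near-centre : ∀ {x} → x ∈ S → x ∈ N[_] G (centre (block x))
      near-centre {x} x∈S = subst (λ y → y ∈ N[_] G (centre (block x))) (guard-block x∈S) (guard-near (block x))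

      block-injective : ∀ {x y} → x ∈ S → y ∈ S → block x ≡ block y → x ≡ y
      block-injective x∈S y∈S eq = trans (≡-sym (guard-block x∈S)) (trans (cong guard eq) (guard-block y∈S))

module _ {n} {P : Subset n} {u w : Fin n} where

  ∈-exchange⁻ : ∀ {x} → x ∈ (P ─ ⁅ u ⁆) ∪ ⁅ w ⁆ → (x ∈ P × x ≢ u) ⊎ x ≡ w
  ∈-exchange⁻ x∈ with x∈p∪q⁻ (P ─ ⁅ u ⁆) ⁅ w ⁆ x∈
  ... | inj₁ x∈P─u = let x∈P , x∈∁u = x∈p∩q⁻ P (∁ ⁅ u ⁆) x∈P─u in
                     inj₁ (x∈P , x∉⁅y⁆⇒x≢y (x∈∁p⇒x∉p x∈∁u))
  ... | inj₂ x∈w   = inj₂ (x∈⁅y⁆⇒x≡y w x∈w)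

  ∉-exchange : ∀ {x} → x ∈ P → x ∉ (P ─ ⁅ u ⁆) ∪ ⁅ w ⁆ → x ≡ u
  ∉-exchange {x} x∈P x∉ with x ≟ u
  ... | yes x≡u = x≡u
  ... | no  x≢u = ⊥-elim (x∉ (x∈p∪q⁺ (inj₁ (x∈p∩q⁺ (x∈P , x∉p⇒x∈∁p (x≢y⇒x∉⁅y⁆ x≢u))))))

module _ {n} {C : Subset n} {a : Fin n} where

  ∈-add⁻ : ∀ {x} → x ∈ C ∪ ⁅ a ⁆ → x ∈ C ⊎ x ≡ a
  ∈-add⁻ x∈ with x∈p∪q⁻ C ⁅ a ⁆ x∈
  ... | inj₁ x∈C = inj₁ x∈C
  ... | inj₂ x∈a = inj₂ (x∈⁅y⁆⇒x≡y a x∈a)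

  add-remove : a ∉ C → (C ∪ ⁅ a ⁆) ─ ⁅ a ⁆ ≡ C
  add-remove a∉C = ⊆-antisym removed⊆C C⊆removed
    where
    removed⊆C : (C ∪ ⁅ a ⁆) ─ ⁅ a ⁆ ⊆ C
    removed⊆C x∈ with x∈p∩q⁻ (C ∪ ⁅ a ⁆) (∁ ⁅ a ⁆) x∈
    ... | x∈C∪a , x∈∁a with ∈-add⁻ x∈C∪a
    ...   | inj₁ x∈C = x∈C
    ...   | inj₂ x≡a = contradiction (subst (_∈ ⁅ a ⁆) (≡-sym x≡a) (x∈⁅x⁆ a)) (x∈∁p⇒x∉p x∈∁a)
    C⊆removed : C ⊆ (C ∪ ⁅ a ⁆) ─ ⁅ a ⁆
    C⊆removed {x} x∈C = x∈p∩q⁺ (x∈p∪q⁺ (inj₁ x∈C) , x∉p⇒x∈∁p (x≢y⇒x∉⁅y⁆ x≢a))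
      where
      x≢a : x ≢ a
      x≢a x≡a = a∉C (subst (_∈ C) x≡a x∈C)

-- G(γ_L) has no loops: an exchange along an edge always changes the set.
γLAdj-irreflexive : ∀ G {S} → ¬ γLAdj G S S
γLAdj-irreflexive G (u , w , u∈S , _ , uw , S≡S′) with ∈-exchange⁻ (subst (u ∈_) S≡S′ u∈S)
... | inj₁ (_ , u≢u) = u≢u refl
... | inj₂ u≡w = contradiction (subst (λ y → adj G u y ≡ true) (≡-sym u≡w) uw)
                               (λ uu → apart uu (irrefl G u) refl)

module _ (G : Graph) {C : Subset (order G)} {a b : Fin (order G)} (a∉C : a ∉ C) (b∉C : b ∉ C) where

  exchange-along-edge : adj G a b ≡ true → γLAdj G (C ∪ ⁅ a ⁆) (C ∪ ⁅ b ⁆)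
  exchange-along-edge ab =
    a , b , x∈p∪q⁺ (inj₂ (x∈⁅x⁆ a)) , x∈p∪q⁺ (inj₂ (x∈⁅x⁆ b)) , ab ,
    cong (_∪ ⁅ b ⁆) (≡-sym (add-remove a∉C))

  exchange-is-edge : γLAdj G (C ∪ ⁅ a ⁆) (C ∪ ⁅ b ⁆) → adj G a b ≡ true
  exchange-is-edge γab@(u , w , _ , _ , uw , exchanged) with a ≟ b
  ... | yes a≡b = ⊥-elim (γLAdj-irreflexive G (subst (λ y → γLAdj G (C ∪ ⁅ a ⁆) (C ∪ ⁅ y ⁆)) (≡-sym a≡b) γab))
  ... | no  a≢b = subst₂ (λ x y → adj G x y ≡ true) (≡-sym a≡u) (≡-sym b≡w) uw
    where
    a∉C∪b : a ∉ C ∪ ⁅ b ⁆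
    a∉C∪b a∈ with ∈-add⁻ a∈
    ... | inj₁ a∈C = a∉C a∈C
    ... | inj₂ a≡b = a≢b a≡b

    a≡u : a ≡ u
    a≡u = ∉-exchange (x∈p∪q⁺ (inj₂ (x∈⁅x⁆ a))) (subst (a ∉_) exchanged a∉C∪b)

    b≡w : b ≡ w
    b≡w with ∈-exchange⁻ (subst (b ∈_) exchanged (x∈p∪q⁺ (inj₂ (x∈⁅x⁆ b))))
    ... | inj₂ b≡w = b≡w
    ... | inj₁ (b∈C∪a , _) with ∈-add⁻ b∈C∪a
    ...   | inj₁ b∈C = ⊥-elim (b∉C b∈C)
    ...   | inj₂ b≡a = ⊥-elim (a≢b (≡-sym b≡a))

≅⇒order≡ : ∀ {G G′} → G ≅ G′ → order G ≡ order G′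
≅⇒order≡ (e , _) = cantor-schröder-bernstein (Injection.injective (↔⇒↣ e)) (Injection.injective (↔⇒↣ (↔-sym e)))

-- Everything about locating-dominating sets can then be read off on V.
module VertexType {V : Set} (_≟V_ : DecidableEquality V) {N : ℕ} (code : Fin N ↔ V)
                  (edge : V → V → Bool)
                  (edge-sym : ∀ u v → edge u v ≡ edge v u)
                  (edge-irrefl : ∀ v → edge v v ≡ false) where

  vertex : Fin N → V
  vertex = Inverse.to code

  index : V → Fin N
  index = Inverse.from code

  vertex-index : ∀ v → vertex (index v) ≡ v
  vertex-index = Inverse.strictlyInverseˡ code

  index-vertex : ∀ x → index (vertex x) ≡ x
  index-vertex = Inverse.strictlyInverseʳ code

  vertex-injective : Injective _≡_ _≡_ vertex
  vertex-injective {x} {y} eq = trans (≡-sym (index-vertex x)) (trans (cong index eq) (index-vertex y))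

  index-injective : Injective _≡_ _≡_ index
  index-injective {u} {v} eq = trans (≡-sym (vertex-index u)) (trans (cong vertex eq) (vertex-index v))

  graph : Graph
  graph = record
    { order  = N
    ; adj    = λ x y → edge (vertex x) (vertex y)
    ; sym    = λ x y → edge-sym (vertex x) (vertex y)
    ; irrefl = λ x → edge-irrefl (vertex x)
    }

  closed : V → V → Bool
  closed u w = does (u ≟V w) ∨ edge u w

  closed-refl : ∀ v → closed v v ≡ true
  closed-refl v = cong (_∨ edge v v) (dec-true (v ≟V v) refl)

  lookup-N : ∀ x y → lookup (N[_] graph x) y ≡ closed (vertex x) (vertex y)
  lookup-N x y = trans (lookup∘tabulate _ y)
    (cong (_∨ edge (vertex x) (vertex y)) (does-⇔ (mk⇔ (cong vertex) vertex-injective) (x ≟ y) (vertex x ≟V vertex y)))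

  ∈N⇒closed : ∀ u {x} → x ∈ N[_] graph (index u) → closed u (vertex x) ≡ true
  ∈N⇒closed u {x} x∈N = subst (λ v → closed v (vertex x) ≡ true) (vertex-index u)
                                (trans (≡-sym (lookup-N (index u) x)) ([]=⇒lookup x∈N))

  χ : Subset N → V → Bool
  χ S v = lookup S (index v)

  ⟦_⟧ : (V → Bool) → Subset N
  ⟦ s ⟧ = tabulate (s ∘ vertex)

  lookup-⟦⟧ : ∀ s x → lookup ⟦ s ⟧ x ≡ s (vertex x)
  lookup-⟦⟧ s = lookup∘tabulate (s ∘ vertex)

  χ-⟦⟧ : ∀ s v → χ ⟦ s ⟧ v ≡ s v
  χ-⟦⟧ s v = trans (lookup-⟦⟧ s (index v)) (cong s (vertex-index v))

  ⟦χ⟧ : ∀ S s → (∀ v → s v ≡ χ S v) → ⟦ s ⟧ ≡ S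
  ⟦χ⟧ S s s≗χS = subset-ext λ x → trans (lookup-⟦⟧ s x) (trans (s≗χS (vertex x)) (cong (lookup S) (index-vertex x)))

  ⟦⟧-add : ∀ s v → ⟦ (λ w → s w ∨ does (v ≟V w)) ⟧ ≡ ⟦ s ⟧ ∪ ⁅ index v ⁆
  ⟦⟧-add s v = subset-ext λ x → begin
    lookup ⟦ (λ w → s w ∨ does (v ≟V w)) ⟧ x        ≡⟨ lookup-⟦⟧ (λ w → s w ∨ does (v ≟V w)) x ⟩
    s (vertex x) ∨ does (v ≟V vertex x)              ≡⟨ cong₂ _∨_ (≡-sym (lookup-⟦⟧ s x)) (index≟ x) ⟩
    lookup ⟦ s ⟧ x ∨ lookup ⁅ index v ⁆ x            ≡⟨ lookup-zipWith _∨_ x ⟦ s ⟧ ⁅ index v ⁆ ⟨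
    lookup (⟦ s ⟧ ∪ ⁅ index v ⁆) x                   ∎
    where
    open ≡-Reasoning
    index≟ : ∀ x → does (v ≟V vertex x) ≡ lookup ⁅ index v ⁆ x
    index≟ x = trans (does-⇔ (mk⇔ (λ v≡ → trans (cong index v≡) (index-vertex x))
                                  (λ i≡ → trans (≡-sym (vertex-index v)) (cong vertex i≡)))
                             (v ≟V vertex x) (index v ≟ x))
                     (≡-sym (lookup-⁅⁆ (index v) x))

  trace : (V → Bool) → V → V → Bool
  trace s u w = s w ∧ closed u w

  Dominates : (V → Bool) → Set
  Dominates s = ∀ u → ∃ λ w → closed u w ≡ true × s w ≡ true

  record Distinguished (s : V → Bool) (u v : V) : Set where
    constructor told-apart-at
    field
      witness : V
      differs : trace s u witness ≢ trace s v witness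

  Locates : (V → Bool) → Set
  Locates s = ∀ u v → s u ≡ false → s v ≡ false → u ≢ v → Distinguished s u v

  same-trace : ∀ {s} u v → (∀ w → s w ≡ true → closed u w ≡ closed v w) → ∀ w → trace s u w ≡ trace s v w
  same-trace {s} u v agree w with s w in sw
  ... | true  = agree w sw
  ... | false = refl

  lookup-N∩ : ∀ S x w → lookup (N[_] graph x ∩ S) (index w) ≡ trace (χ S) (vertex x) w
  lookup-N∩ S x w = begin
    lookup (N[_] graph x ∩ S) (index w)                              ≡⟨ lookup-zipWith _∧_ (index w) (N[_] graph x) S ⟩
    lookup (N[_] graph x) (index w) ∧ χ S w                          ≡⟨ ∧-comm _ (χ S w) ⟩
    χ S w ∧ lookup (N[_] graph x) (index w)                          ≡⟨ cong (χ S w ∧_) (lookup-N x (index w)) ⟩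
    χ S w ∧ closed (vertex x) (vertex (index w))                     ≡⟨ cong (λ v → χ S w ∧ closed (vertex x) v) (vertex-index w) ⟩
    trace (χ S) (vertex x) w                                         ∎
    where open ≡-Reasoning

  locating-dominating⁺ : ∀ s → Dominates s → Locates s → IsLocatingDominating graph ⟦ s ⟧
  locating-dominating⁺ s dominates locates = dominating , locating
    where
    in-trace : ∀ x w → lookup (N[_] graph x ∩ ⟦ s ⟧) (index w) ≡ trace s (vertex x) w
    in-trace x w = trans (lookup-N∩ ⟦ s ⟧ x w) (cong (_∧ closed (vertex x) w) (χ-⟦⟧ s w))

    outside : ∀ {z} → z ∉ ⟦ s ⟧ → s (vertex z) ≡ false
    outside {z} z∉ = ¬-not λ sz → z∉ (lookup⇒[]= z _ (trans (lookup-⟦⟧ s z) sz))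

    dominating : IsDominating graph ⟦ s ⟧
    dominating x with dominates (vertex x)
    ... | w , closed-xw , sw = index w , lookup⇒[]= (index w) _ (trans (in-trace x w) (cong₂ _∧_ sw closed-xw))

    locating : ∀ x y → x ∉ ⟦ s ⟧ → y ∉ ⟦ s ⟧ → x ≢ y → N[_] graph x ∩ ⟦ s ⟧ ≢ N[_] graph y ∩ ⟦ s ⟧
    locating x y x∉ y∉ x≢y same
      with told-apart-at w differs ← locates (vertex x) (vertex y) (outside x∉) (outside y∉) (x≢y ∘ vertex-injective)
      = differs (trans (≡-sym (in-trace x w)) (trans (cong (λ S → lookup S (index w)) same) (in-trace y w)))

  dominates⁻ : ∀ {S} → IsDominating graph S → Dominates (χ S)
  dominates⁻ {S} dominating u with dominating (index u)
  ... | x , x∈ with x∈p∩q⁻ (N[_] graph (index u)) S x∈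
  ...   | x∈N , x∈S = vertex x , ∈N⇒closed u x∈N , trans (cong (lookup S) (index-vertex x)) ([]=⇒lookup x∈S)

  -- A locating set need not name a distinguishing vertex, but two distinct
  -- non-members never have the same trace.
  located⁻ : ∀ {S} → IsLocatingDominating graph S → ∀ u v → χ S u ≡ false → χ S v ≡ false → u ≢ v →
             ¬ (∀ w → trace (χ S) u w ≡ trace (χ S) v w)
  located⁻ {S} (_ , locating) u v Su Sv u≢v same =
    locating (index u) (index v) (false⇒∉ Su) (false⇒∉ Sv) (u≢v ∘ index-injective)
      (subset-ext λ x → trans (trace-at u x) (trans (same (vertex x)) (≡-sym (trace-at v x))))
    where
    trace-at : ∀ u x → lookup (N[_] graph (index u) ∩ S) x ≡ trace (χ S) u (vertex x)
    trace-at u x = trans (cong (lookup (N[_] graph (index u) ∩ S)) (≡-sym (index-vertex x)))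
                         (trans (lookup-N∩ S (index u) (vertex x)) (cong (λ v → trace (χ S) v (vertex x)) (vertex-index u)))

  ⟦⟧-size : ∀ {K} s (slot : Fin K → V) → (∀ v → s v ≡ true → ∃ λ c → slot c ≡ v) → ∣ ⟦ s ⟧ ∣ ≤ K
  ⟦⟧-size s slot covers = size-≤ ⟦ s ⟧ (index ∘ slot) λ {x} x∈ →
    let c , slot-c≡ = covers (vertex x) (trans (≡-sym (lookup-⟦⟧ s x)) ([]=⇒lookup x∈)) in
    c , trans (cong index slot-c≡) (index-vertex x)

_⊕_ : ∀ {a b} {A B : Set} → Fin a ↔ A → Fin b ↔ B → Fin (a + b) ↔ (A ⊎ B)
e ⊕ f = ↔-trans +↔⊎ (e ⊎-↔ f)

module Construction (H : Graph) (k : ℕ) where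

  n m : ℕ
  n = order H
  m = suc (n + k)

  V : Set
  V = ⊤ ⊎ ⊤ ⊎ Fin n ⊎ Fin m ⊎ Fin m ⊎ Fin m ⊎ Fin m ⊎ Fin m

  pattern vY   = inj₁ tt
  pattern vZ   = inj₂ (inj₁ tt)
  pattern vA j = inj₂ (inj₂ (inj₁ j))
  pattern vQ b = inj₂ (inj₂ (inj₂ (inj₁ b)))
  pattern vP b = inj₂ (inj₂ (inj₂ (inj₂ (inj₁ b))))
  pattern vR b = inj₂ (inj₂ (inj₂ (inj₂ (inj₂ (inj₁ b)))))
  pattern vS b = inj₂ (inj₂ (inj₂ (inj₂ (inj₂ (inj₂ (inj₁ b))))))
  pattern vT b = inj₂ (inj₂ (inj₂ (inj₂ (inj₂ (inj₂ (inj₂ b))))))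

  _≟V_ : DecidableEquality V
  _≟V_ = ≡-dec Unit._≟_ (≡-dec Unit._≟_ (≡-dec _≟_ (≡-dec _≟_ (≡-dec _≟_ (≡-dec _≟_ (≡-dec _≟_ _≟_))))))

  N : ℕ
  N = 1 + (1 + (n + (m + (m + (m + (m + m))))))

  code : Fin N ↔ V
  code = 1↔⊤ ⊕ (1↔⊤ ⊕ (↔-refl ⊕ (↔-refl ⊕ (↔-refl ⊕ (↔-refl ⊕ (↔-refl ⊕ ↔-refl))))))

  pA : Fin n → Fin m
  pA j = suc (j ↑ˡ k)

  vA-injective : ∀ {i j : Fin n} → vA i ≡ (V ∋ vA j) → i ≡ j
  vA-injective refl = refl

  pA-injective : Injective _≡_ _≡_ pA
  pA-injective eq = ↑ˡ-injective k _ _ (suc-injective eq)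

  -- Each edge listed once; `edge` is the symmetric closure.
  -- Besides the edges of H and of the paths: Y A_j, Z A_j, Y P_0, A_j P_(j+1), A_j S_0.
  arc : V → V → Bool
  arc (vA i) (vA j) = adj H i j
  arc vY     (vA _) = true
  arc vZ     (vA _) = true
  arc (vA _) (vS b) = does (zero ≟ b)
  arc (vP b) vY     = does (b ≟ zero)
  arc (vP b) (vA j) = does (b ≟ pA j)
  arc (vP a) (vQ b) = does (a ≟ b)
  arc (vP a) (vR b) = does (a ≟ b)
  arc (vS a) (vR b) = does (a ≟ b)
  arc (vS a) (vT b) = does (a ≟ b)
  arc _      _      = false

  arc-irrefl : ∀ v → arc v v ≡ false
  arc-irrefl vY     = refl
  arc-irrefl vZ     = refl
  arc-irrefl (vA j) = irrefl H j
  arc-irrefl (vQ _) = refl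
  arc-irrefl (vP _) = refl
  arc-irrefl (vR _) = refl
  arc-irrefl (vS _) = refl
  arc-irrefl (vT _) = refl

  edge : V → V → Bool
  edge u v = arc u v ∨ arc v u

  edge-irrefl : ∀ v → edge v v ≡ false
  edge-irrefl v = cong₂ _∨_ (arc-irrefl v) (arc-irrefl v)

  open VertexType _≟V_ code edge (λ u v → ∨-comm (arc u v) (arc v u)) edge-irrefl public

  G : Graph
  G = graph

  edge-A : ∀ i j → adj G (index (vA i)) (index (vA j)) ≡ adj H i j
  edge-A i j = begin
    edge (vertex (index (vA i))) (vertex (index (vA j)))   ≡⟨ cong₂ edge (vertex-index (vA i)) (vertex-index (vA j)) ⟩
    adj H i j ∨ adj H j i                                  ≡⟨ cong (adj H i j ∨_) (sym H j i) ⟩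
    adj H i j ∨ adj H i j                                  ≡⟨ ∨-idem (adj H i j) ⟩
    adj H i j                                              ∎
    where open ≡-Reasoning

  itself : ∀ {b c : Fin m} → does (b ≟ c) ∨ false ≡ true → c ≡ b
  itself {b} {c} e = ≡-sym (decided (b ≟ c) (trans (≡-sym (∨-identityʳ _)) e))

  closed-Z : ∀ w → closed vZ w ≡ true → w ≡ vZ ⊎ ∃ λ j → w ≡ vA j
  closed-Z vZ     _ = inj₁ refl
  closed-Z (vA j) _ = inj₂ (j , refl)
  closed-Z vY     ()
  closed-Z (vQ _) ()
  closed-Z (vP _) ()
  closed-Z (vR _) ()
  closed-Z (vS _) ()
  closed-Z (vT _) ()

  closed-Q : ∀ b w → closed (vQ b) w ≡ true → w ≡ vQ b ⊎ w ≡ vP b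
  closed-Q b (vQ c) e = inj₁ (cong vQ (itself e))
  closed-Q b (vP c) e = inj₂ (cong vP (decided (c ≟ b) e))
  closed-Q b vY     ()
  closed-Q b vZ     ()
  closed-Q b (vA _) ()
  closed-Q b (vR _) ()
  closed-Q b (vS _) ()
  closed-Q b (vT _) ()

  closed-R : ∀ b w → closed (vR b) w ≡ true → w ≡ vR b ⊎ w ≡ vP b ⊎ w ≡ vS b
  closed-R b (vR c) e = inj₁ (cong vR (itself e))
  closed-R b (vP c) e = inj₂ (inj₁ (cong vP (decided (c ≟ b) e)))
  closed-R b (vS c) e = inj₂ (inj₂ (cong vS (decided (c ≟ b) e)))
  closed-R b vY     ()
  closed-R b vZ     ()
  closed-R b (vA _) ()
  closed-R b (vQ _) ()
  closed-R b (vT _) ()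

  closed-T : ∀ b w → closed (vT b) w ≡ true → w ≡ vT b ⊎ w ≡ vS b
  closed-T b (vT c) e = inj₁ (cong vT (itself e))
  closed-T b (vS c) e = inj₂ (cong vS (decided (c ≟ b) e))
  closed-T b vY     ()
  closed-T b vZ     ()
  closed-T b (vA _) ()
  closed-T b (vQ _) ()
  closed-T b (vP _) ()
  closed-T b (vR _) ()

  -- The packing: the K = 2m + 1 vertices Z, Q_b, T_b have disjoint closed neighbourhoods.
  K : ℕ
  K = suc (m + m)

  centre : Fin K → V
  centre zero    = vZ
  centre (suc c) = [ vQ , vT ]′ (splitAt m c)

  blockOf : V → Fin K
  blockOf (vQ b) = suc (b ↑ˡ m)
  blockOf (vP b) = suc (b ↑ˡ m)
  blockOf (vS b) = suc (m ↑ʳ b)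
  blockOf (vT b) = suc (m ↑ʳ b)
  blockOf _      = zero

  blockOf-centre : ∀ c w → closed (centre c) w ≡ true → blockOf w ≡ c
  blockOf-centre zero w e with closed-Z w e
  ... | inj₁ refl       = refl
  ... | inj₂ (_ , refl) = refl
  blockOf-centre (suc c) w e with splitAt m c | join-splitAt m m c
  ... | inj₁ b | joined with closed-Q b w e
  ...   | inj₁ refl = cong suc joined
  ...   | inj₂ refl = cong suc joined
  blockOf-centre (suc c) w e | inj₂ b | joined with closed-T b w e
  ...   | inj₁ refl = cong suc joined
  ...   | inj₂ refl = cong suc joined

  open Packing G (index ∘ centre) (blockOf ∘ vertex) (λ c x∈ → blockOf-centre c _ (∈N⇒closed (centre c) x∈))

  core : V → Bool
  core (vP _) = true
  core (vS _) = true
  core _      = false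

  member : Fin n → V → Bool
  member i w = core w ∨ does (vA i ≟V w)

  Sᵢ : Fin n → Subset N
  Sᵢ i = ⟦ member i ⟧

  module Member (i : Fin n) where

    Aᵢ∈ : member i (vA i) ≡ true
    Aᵢ∈ = dec-true (i ≟ i) refl

    dominates : Dominates (member i)
    dominates vY     = vP zero , refl , refl
    dominates vZ     = vA i , refl , Aᵢ∈
    dominates (vA _) = vS zero , refl , refl
    dominates (vQ b) = vP b , dec-true (b ≟ b) refl , refl
    dominates (vP b) = vP b , closed-refl (vP b) , refl
    dominates (vR b) = vP b , dec-true (b ≟ b) refl , refl
    dominates (vS b) = vS b , closed-refl (vS b) , refl
    dominates (vT b) = vS b , dec-true (b ≟ b) refl , refl

    -- Non-members are told apart by A_i, by P_0 or S_0, or by a vertex of one of their paths.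
    apart-at-Aᵢ : ∀ {u v} → closed u (vA i) ≢ closed v (vA i) → Distinguished (member i) u v
    apart-at-Aᵢ {u} {v} differ = told-apart-at (vA i) λ same →
      differ (trans (≡-sym (at-Aᵢ u)) (trans same (at-Aᵢ v)))
      where
      at-Aᵢ : ∀ u → trace (member i) u (vA i) ≡ closed u (vA i)
      at-Aᵢ u = cong (_∧ closed u (vA i)) Aᵢ∈

    own : ∀ {x y : Fin m} → x ≢ y → does (x ≟ x) ≢ does (x ≟ y)
    own {x} {y} x≢y = apart (dec-true (x ≟ x) refl) (dec-false (x ≟ y) x≢y)

    own′ : ∀ (x : Fin m) → does (x ≟ x) ≢ false
    own′ x = apart (dec-true (x ≟ x) refl) refl

    locates : Locates (member i)
    locates vY     vY     _ _ u≢v = ⊥-elim (u≢v refl)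
    locates vY     vZ     _ _ _   = told-apart-at (vP zero) λ ()
    locates vY     (vA _) _ _ _   = told-apart-at (vP zero) λ ()
    locates vY     (vQ _) _ _ _   = apart-at-Aᵢ λ ()
    locates vY     (vR _) _ _ _   = apart-at-Aᵢ λ ()
    locates vY     (vT _) _ _ _   = apart-at-Aᵢ λ ()
    locates vZ     vY     _ _ _   = told-apart-at (vP zero) λ ()
    locates vZ     vZ     _ _ u≢v = ⊥-elim (u≢v refl)
    locates vZ     (vA _) _ _ _   = told-apart-at (vS zero) λ ()
    locates vZ     (vQ _) _ _ _   = apart-at-Aᵢ λ ()
    locates vZ     (vR _) _ _ _   = apart-at-Aᵢ λ ()
    locates vZ     (vT _) _ _ _   = apart-at-Aᵢ λ ()
    locates (vA _) vY     _ _ _   = told-apart-at (vP zero) λ ()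
    locates (vA _) vZ     _ _ _   = told-apart-at (vS zero) λ ()
    locates (vA a) (vA b) _ _ u≢v = told-apart-at (vP (pA a)) (own (u≢v ∘ cong vA ∘ pA-injective))
    locates (vA _) (vQ _) _ _ _   = told-apart-at (vS zero) λ ()
    locates (vA a) (vR zero)    _ _ _ = told-apart-at (vP (pA a)) (own′ (pA a))
    locates (vA _) (vR (suc _)) _ _ _ = told-apart-at (vS zero) λ ()
    locates (vA a) (vT _) _ _ _   = told-apart-at (vP (pA a)) (own′ (pA a))
    locates (vQ _) vY     _ _ _   = apart-at-Aᵢ λ ()
    locates (vQ _) vZ     _ _ _   = apart-at-Aᵢ λ ()
    locates (vQ _) (vA _) _ _ _   = told-apart-at (vS zero) λ ()
    locates (vQ a) (vQ b) _ _ u≢v = told-apart-at (vP a) (own (u≢v ∘ cong vQ))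
    locates (vQ _) (vR b) _ _ _   = told-apart-at (vS b) (≢-sym (own′ b))
    locates (vQ _) (vT b) _ _ _   = told-apart-at (vS b) (≢-sym (own′ b))
    locates (vR _) vY     _ _ _   = apart-at-Aᵢ λ ()
    locates (vR _) vZ     _ _ _   = apart-at-Aᵢ λ ()
    locates (vR zero)    (vA a) _ _ _ = told-apart-at (vP (pA a)) (≢-sym (own′ (pA a)))
    locates (vR (suc _)) (vA _) _ _ _ = told-apart-at (vS zero) λ ()
    locates (vR b) (vQ _) _ _ _   = told-apart-at (vS b) (own′ b)
    locates (vR a) (vR b) _ _ u≢v = told-apart-at (vP a) (own (u≢v ∘ cong vR))
    locates (vR a) (vT _) _ _ _   = told-apart-at (vP a) (own′ a)
    locates (vT _) vY     _ _ _   = apart-at-Aᵢ λ ()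
    locates (vT _) vZ     _ _ _   = apart-at-Aᵢ λ ()
    locates (vT _) (vA a) _ _ _   = told-apart-at (vP (pA a)) (≢-sym (own′ (pA a)))
    locates (vT b) (vQ _) _ _ _   = told-apart-at (vS b) (own′ b)
    locates (vT _) (vR a) _ _ _   = told-apart-at (vP a) (≢-sym (own′ a))
    locates (vT a) (vT b) _ _ u≢v = told-apart-at (vS a) (own (u≢v ∘ cong vT))
    locates (vP _) _      () _ _
    locates (vS _) _      () _ _
    locates _      (vP _) _ () _
    locates _      (vS _) _ () _

    slot : Fin K → V
    slot zero    = vA i
    slot (suc c) = [ vP , vS ]′ (splitAt m c)

    covered : ∀ v → member i v ≡ true → ∃ λ c → slot c ≡ v
    covered (vA j) Aⱼ∈ = zero , cong vA (decided (i ≟ j) Aⱼ∈)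
    covered (vP b) _   = suc (b ↑ˡ m) , cong [ vP , vS ]′ (splitAt-↑ˡ m b m)
    covered (vS b) _   = suc (m ↑ʳ b) , cong [ vP , vS ]′ (splitAt-↑ʳ m m b)
    covered vY     ()
    covered vZ     ()
    covered (vQ _) ()
    covered (vR _) ()
    covered (vT _) ()

  Sᵢ-locating-dominating : ∀ i → IsLocatingDominating G (Sᵢ i)
  Sᵢ-locating-dominating i = locating-dominating⁺ (member i) (Member.dominates i) (Member.locates i)

  Sᵢ-size : ∀ i → ∣ Sᵢ i ∣ ≤ K
  Sᵢ-size i = ⟦⟧-size (member i) (Member.slot i) (Member.covered i)

  -- S_i attains the packing bound, so it is a γ_L-set.
  Sᵢ-γL : ∀ i → IsγLSet G (Sᵢ i)
  Sᵢ-γL i = Sᵢ-locating-dominating i , λ T ld → ℕ.≤-trans (Sᵢ-size i) (packing-bound (proj₁ ld))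

  Sᵢ-injective : Injective _≡_ _≡_ Sᵢ
  Sᵢ-injective {i} {j} Sᵢ≡Sⱼ = decided (i ≟ j) (begin
    member i (vA j)      ≡⟨ χ-⟦⟧ (member i) (vA j) ⟨
    χ (Sᵢ i) (vA j)      ≡⟨ cong (λ S → χ S (vA j)) Sᵢ≡Sⱼ ⟩
    χ (Sᵢ j) (vA j)      ≡⟨ χ-⟦⟧ (member j) (vA j) ⟩
    member j (vA j)      ≡⟨ Member.Aᵢ∈ j ⟩
    true                 ∎)
    where open ≡-Reasoning

  -- S_i and S_j differ by exchanging A_i and A_j.
  Sᵢ-adjacent : ∀ i j → (adj H i j ≡ true → γLAdj G (Sᵢ i) (Sᵢ j)) × (γLAdj G (Sᵢ i) (Sᵢ j) → adj H i j ≡ true)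
  Sᵢ-adjacent i j rewrite ⟦⟧-add core (vA i) | ⟦⟧-add core (vA j) | ≡-sym (edge-A i j) =
    exchange-along-edge G (A∉core i) (A∉core j) , exchange-is-edge G (A∉core i) (A∉core j)
    where
    A∉core : ∀ i → index (vA i) ∉ ⟦ core ⟧
    A∉core i = false⇒∉ (χ-⟦⟧ core (vA i))

  module Rigidity (i₀ : Fin n) {S : Subset N} (γ : IsγLSet G S) where

    s : V → Bool
    s = χ S

    dominated : Dominates s
    dominated = dominates⁻ (proj₁ (proj₁ γ))

    -- S is no larger than S_(i₀), hence meets the packing bound with equality.
    open Tight (proj₁ (proj₁ γ)) (ℕ.≤-trans (proj₂ γ (Sᵢ i₀) (Sᵢ-locating-dominating i₀)) (Sᵢ-size i₀))

    in-S : ∀ v → s v ≡ true → index v ∈ S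
    in-S v sv = lookup⇒[]= (index v) S sv

    near : ∀ v → s v ≡ true → closed (centre (blockOf v)) v ≡ true
    near v sv = subst (λ u → closed (centre (blockOf u)) u ≡ true) (vertex-index v)
                      (∈N⇒closed (centre (blockOf (vertex (index v)))) (near-centre (in-S v sv)))

    alone : ∀ u v → s u ≡ true → s v ≡ true → blockOf u ≡ blockOf v → u ≡ v
    alone u v su sv same-block = index-injective (block-injective (in-S u su) (in-S v sv)
      (trans (cong blockOf (vertex-index u)) (trans same-block (cong blockOf (≡-sym (vertex-index v))))))

    located : ∀ u v → s u ≡ false → s v ≡ false → u ≢ v → ¬ (∀ w → trace s u w ≡ trace s v w)
    located = located⁻ (proj₁ γ)

    -- Y and the R_b lie in no packing neighbourhood.
    Y∉ : s vY ≡ false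
    Y∉ = ¬-not λ sY → contradiction (near vY sY) λ ()

    R∉ : ∀ b → s (vR b) ≡ false
    R∉ b = ¬-not λ sR → contradiction (near (vR b) sR) λ ()

    distinct-indices : ∀ (X : Fin m → V) {b c} → s (X b) ≡ true → s (X c) ≡ false → b ≢ c
    distinct-indices X sb sc refl = apart sb sc refl

    -- If P_b ∉ S then R_b is dominated by S_b, so T_b ∉ S, and R_b, T_b both see only S_b.
    P∈ : ∀ b → s (vP b) ≡ true
    P∈ b with s (vP b) in P∉
    ... | true  = refl
    ... | false = ⊥-elim (located (vR b) (vT b) (R∉ b) T∉ (λ ()) (same-trace (vR b) (vT b) agree))
      where
      S∈ : s (vS b) ≡ true
      S∈ with dominated (vR b)
      ... | w , Rw , sw with closed-R b w Rw
      ...   | inj₁ refl        = contradiction (trans (≡-sym sw) (R∉ b)) λ ()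
      ...   | inj₂ (inj₁ refl) = contradiction (trans (≡-sym sw) P∉) λ ()
      ...   | inj₂ (inj₂ refl) = sw

      T∉ : s (vT b) ≡ false
      T∉ = ¬-not λ sT → contradiction (alone (vS b) (vT b) S∈ sT refl) λ ()

      agree : ∀ w → s w ≡ true → closed (vR b) w ≡ closed (vT b) w
      agree vY     _  = refl
      agree vZ     _  = refl
      agree (vA _) _  = refl
      agree (vQ _) _  = refl
      agree (vP c) sw = dec-false (c ≟ b) (distinct-indices vP sw P∉)
      agree (vR c) sw = contradiction (trans (≡-sym sw) (R∉ c)) λ ()
      agree (vS _) _  = refl
      agree (vT c) sw = ≡-sym (cong (_∨ false) (dec-false (b ≟ c) (≢-sym (distinct-indices vT sw T∉))))

    Q∉ : ∀ b → s (vQ b) ≡ false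
    Q∉ b = ¬-not λ sQ → contradiction (alone (vQ b) (vP b) sQ (P∈ b) refl) λ ()

    -- If S_b ∉ S then Q_b and R_b both see only P_b.
    S∈ : ∀ b → s (vS b) ≡ true
    S∈ b with s (vS b) in S∉
    ... | true  = refl
    ... | false = ⊥-elim (located (vQ b) (vR b) (Q∉ b) (R∉ b) (λ ()) (same-trace (vQ b) (vR b) agree))
      where
      agree : ∀ w → s w ≡ true → closed (vQ b) w ≡ closed (vR b) w
      agree vY     _  = refl
      agree vZ     _  = refl
      agree (vA _) _  = refl
      agree (vQ c) sw = cong (_∨ false) (dec-false (b ≟ c) (≢-sym (distinct-indices vQ sw (Q∉ b))))
      agree (vP _) _  = refl
      agree (vR c) sw = contradiction (trans (≡-sym sw) (R∉ c)) λ ()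
      agree (vS c) sw = ≡-sym (dec-false (c ≟ b) (distinct-indices vS sw S∉))
      agree (vT _) _  = refl

    T∉ : ∀ b → s (vT b) ≡ false
    T∉ b = ¬-not λ sT → contradiction (alone (vS b) (vT b) (S∈ b) sT refl) λ ()

    -- If Z ∈ S then no A_j is in S, and Y and Q_0 both see only P_0.
    Z∉ : s vZ ≡ false
    Z∉ with s vZ in Z∈
    ... | false = refl
    ... | true  = ⊥-elim (located vY (vQ zero) Y∉ (Q∉ zero) (λ ()) (same-trace vY (vQ zero) agree))
      where
      A∉ : ∀ j → s (vA j) ≡ false
      A∉ j = ¬-not λ sA → contradiction (alone vZ (vA j) Z∈ sA refl) λ ()

      agree : ∀ w → s w ≡ true → closed vY w ≡ closed (vQ zero) w
      agree vY     sw = contradiction (trans (≡-sym sw) Y∉) λ ()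
      agree vZ     _  = refl
      agree (vA j) sw = contradiction (trans (≡-sym sw) (A∉ j)) λ ()
      agree (vQ c) sw = contradiction (trans (≡-sym sw) (Q∉ c)) λ ()
      agree (vP _) _  = refl
      agree (vR _) _  = refl
      agree (vS _) _  = refl
      agree (vT _) _  = refl

    -- Z is dominated, so some A_i is in S; it is the only one.
    some-A : ∃ λ i → s (vA i) ≡ true
    some-A with dominated vZ
    ... | w , Zw , sw with closed-Z w Zw
    ...   | inj₁ refl       = contradiction (trans (≡-sym sw) Z∉) λ ()
    ...   | inj₂ (i , refl) = i , sw

    is-some-Sᵢ : ∃ λ i → Sᵢ i ≡ S
    is-some-Sᵢ = let i , Aᵢ∈ = some-A in i , ⟦χ⟧ S (member i) (member≡ i Aᵢ∈)
      where
      member≡ : ∀ i → s (vA i) ≡ true → ∀ v → member i v ≡ s v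
      member≡ i Aᵢ∈ vY     = ≡-sym Y∉
      member≡ i Aᵢ∈ vZ     = ≡-sym Z∉
      member≡ i Aᵢ∈ (vA j) with i ≟ j
      ... | yes refl = ≡-sym Aᵢ∈
      ... | no  i≢j  = ≡-sym (¬-not λ Aⱼ∈ → i≢j (vA-injective (alone (vA i) (vA j) Aᵢ∈ Aⱼ∈ refl)))
      member≡ i Aᵢ∈ (vQ b) = ≡-sym (Q∉ b)
      member≡ i Aᵢ∈ (vP b) = ≡-sym (P∈ b)
      member≡ i Aᵢ∈ (vR b) = ≡-sym (R∉ b)
      member≡ i Aᵢ∈ (vS b) = ≡-sym (S∈ b)
      member≡ i Aᵢ∈ (vT b) = ≡-sym (T∉ b)

-- 5x unfolded as a sum, as it appears in the number of vertices of G_k.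
fivefold : ∀ x → x + (x + (x + (x + x))) ≡ 5 * x
fivefold x = cong (λ y → x + (x + (x + (x + y)))) (≡-sym (ℕ.+-identityʳ x))

-- G_k has 2 + n + 5(n + k + 1) vertices, which determines k.
order-injective : ∀ H {a b} → order (Construction.G H a) ≡ order (Construction.G H b) → a ≡ b
order-injective H {a} {b} same-order =
  ℕ.+-cancelˡ-≡ n a b (ℕ.suc-injective (ℕ.*-cancelˡ-≡ (m a) (m b) 5 (begin
    5 * m a                                  ≡⟨ fivefold (m a) ⟨
    m a + (m a + (m a + (m a + m a)))        ≡⟨ ℕ.+-cancelˡ-≡ n _ _ (ℕ.suc-injective (ℕ.suc-injective same-order)) ⟩
    m b + (m b + (m b + (m b + m b)))        ≡⟨ fivefold (m b) ⟩
    5 * m b                                  ∎)))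
  where
  n : ℕ
  n = order H
  m : ℕ → ℕ
  m = Construction.m H
  open ≡-Reasoning

theorem7 : (H : Graph) → 1 ≤ order H →
    Σ (ℕ → Graph) λ Gs →
      (∀ k → H ≅γL Gs k) × (∀ i j → i ≢ j → ¬ (Gs i ≅ Gs j))
theorem7 H 1≤n = Construction.G H , represents , non-isomorphic
  where
  represents : ∀ k → H ≅γL Construction.G H k
  represents k = Sᵢ , Sᵢ-γL , Sᵢ-injective , (λ S γ → Rigidity.is-some-Sᵢ (fromℕ< 1≤n) γ) , Sᵢ-adjacent
    where open Construction H k

  non-isomorphic : ∀ a b → a ≢ b → ¬ (Construction.G H a ≅ Construction.G H b)
  non-isomorphic a b a≢b G≅G′ = a≢b (order-injective H (≅⇒order≡ {Construction.G H a} {Construction.G H b} G≅G′))
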